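{- Let $k\ge 3$ and let $G$ be the $k$-sun graph, with $n$ vertices and $m$ edges. Then $W(G)=n(n-1)+W_P(G)-m$.
   Context: For $k\geq 3$, the $k$-sun graph is the graph on the $2k$ vertices $c_1,\dots,c_k,s_1,\dots,s_k$ in which $c_1,\dots,c_k$ form a clique, $s_1,\dots,s_k$ form an independent set, and the remaining edges are $s_ic_i$ and $s_ic_{i+1}$ for $1\le i<k$, together with $s_kc_k$ and $s_kc_1$ (no other edges). $d_G(u,v)$ is the shortest-path distance. The Wiener index is $W(G)=\sum_{\{u,v\}\subseteq V(G)} d_G(u,v)$ over unordered pairs of distinct vertices, and the Wiener polarity index $W_P(G)$ is the number of unordered pairs $\{u,v\}$ of vertices with $d_G(u,v)=3$. -}

module Defs where

open import Data.Nat using (ℕ; zero; suc; _+_; _*_; _∸_; _<?_)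
open import Data.Bool using (Bool; true; false; _∧_; _∨_)
open import Data.Fin using (Fin; toℕ; splitAt; _≟_)
open import Data.Sum using (inj₁; inj₂)
open import Data.Product using (_×_; _,_; proj₁; proj₂)
open import Data.List using (List; []; _∷_; concatMap; filter; map; length; allFin)
open import Data.Bool.ListAction using (any)
open import Data.Nat.ListAction using (sum)
open import Relation.Nullary.Decidable using (⌊_⌋)
import Data.Nat as ℕ

Graph : ℕ → Set
Graph N = Fin N → Fin N → Bool

pairs : (N : ℕ) → List (Fin N × Fin N)
pairs N = concatMap (λ u → map (λ v → (u , v))
                      (filter (λ v → toℕ u <? toℕ v) (allFin N)))
                    (allFin N)

reach : ∀ {N} → Graph N → ℕ → Fin N → Fin N → Bool
reach G zero    u v = ⌊ u ≟ v ⌋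
reach G (suc d) u v = reach G d u v ∨ any (λ w → G u w ∧ reach G d w v) (allFin _)

-- least d with d < bound such that reach G d u v, starting the search at d;
-- returns the search end (= the bound) if none exists.
least : ∀ {N} → Graph N → Fin N → Fin N → (d fuel : ℕ) → ℕ
least G u v d zero       = d
least G u v d (suc fuel) with reach G d u v
... | true  = d
... | false = least G u v (suc d) fuel

-- In a graph on N vertices any two
-- vertices joined by a path are joined by one of length < N, so for a
-- connected graph (such as the k-sun) this is exactly the distance.
-- (Unreachable pairs would get the value N; irrelevant here.)
dist : ∀ {N} → Graph N → Fin N → Fin N → ℕ
dist {N} G u v = least G u v 0 N

wiener : ∀ {N} → Graph N → ℕ
wiener {N} G = sum (map (λ p → dist G (proj₁ p) (proj₂ p)) (pairs N))

wienerPolarity : ∀ {N} → Graph N → ℕ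
wienerPolarity {N} G =
  length (filter (λ p → dist G (proj₁ p) (proj₂ p) ℕ.≟ 3) (pairs N))

edgeCount : ∀ {N} → Graph N → ℕ
edgeCount {N} G = length (filter (λ p → G (proj₁ p) (proj₂ p) Data.Bool.≟ true) (pairs N))
  where import Data.Bool

-- The k-sun graph on vertex set Fin (k + k):
-- vertex i (toℕ i < k) is c_{i+1}, vertex k + i is s_{i+1}.
-- s_i (0-based i) is adjacent to c_i and c_{i+1}, and s_{k-1} to c_{k-1}, c_0.
sunSC : (k : ℕ) → Fin k → Fin k → Bool
sunSC k i j = ⌊ toℕ j ℕ.≟ toℕ i ⌋
            ∨ ⌊ toℕ j ℕ.≟ suc (toℕ i) ⌋
            ∨ (⌊ suc (toℕ i) ℕ.≟ k ⌋ ∧ ⌊ toℕ j ℕ.≟ 0 ⌋)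

sun : (k : ℕ) → Graph (k + k)
sun k u v with splitAt k u | splitAt k v
... | inj₁ i | inj₁ j = Data.Bool.not ⌊ i ≟ j ⌋   where import Data.Bool
... | inj₂ i | inj₁ j = sunSC k i j
... | inj₁ j | inj₂ i = sunSC k i j
... | inj₂ i | inj₂ j = false

-- The k-sun has diameter at most 3: every vertex equals or is adjacent to a
-- clique vertex, and the clique vertices are pairwise adjacent.  In a graph of
-- diameter at most 3 every pair {u,v} of distinct vertices satisfies
-- d(u,v) + [uv ∈ E] = 2 + [d(u,v) = 3]; summing over all n(n-1)/2 pairs gives
-- W + m = n(n-1) + W_P.
module Submission where

open import Defs
open import Data.Nat using (ℕ; zero; suc; _≤_; _+_; _*_; _∸_; _<?_; s≤s; z≤n)
import Data.Nat as ℕ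
open import Data.Nat.Properties using (+-commutativeSemigroup; m+n∸n≡m; <-irrefl; +-mono-≤; ≤-trans)
open import Algebra.Properties.CommutativeSemigroup +-commutativeSemigroup using (interchange)
open import Data.Nat.ListAction using (sum)
open import Data.Nat.Solver using (module +-*-Solver)
open import Data.Bool using (Bool; true; false; not; _∧_)
import Data.Bool as Bool
open import Data.Bool.Properties using (∧-zeroʳ; ∨-zeroʳ)
open import Data.Bool.ListAction using (any)
open import Data.Fin using (Fin; toℕ; splitAt; _≟_; _↑ˡ_)
open import Data.Fin.Properties using (splitAt-↑ˡ; splitAt⁻¹-↑ˡ)
open import Data.Sum using (_⊎_; inj₁; inj₂; [_,_]′)
open import Data.Product using (_×_; _,_; proj₁; proj₂)
open import Data.List using (List; []; _∷_; concatMap; filter; map; length; tabulate; allFin; upTo; applyUpTo)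
open import Data.List.Properties using (length-++; length-map; map-∘; map-cong; map-tabulate; map-upTo; length-upTo)
open import Data.List.Relation.Unary.All as All using (All; []; _∷_)
open import Data.List.Relation.Unary.All.Properties using (concat⁺; map⁺; all-filter)
open import Data.List.Membership.Propositional using (_∈_)
open import Data.List.Membership.Propositional.Properties using (∈-allFin)
open import Data.List.Relation.Unary.Any using (here; there)
open import Relation.Nullary using (Dec; does; ¬_; yes; no)
open import Relation.Nullary.Decidable using (⌊_⌋; isYes≗does; dec-true; dec-false)
open import Relation.Unary using (Pred; Decidable)
open import Relation.Binary.PropositionalEquality using (_≡_; _≢_; refl; sym; trans; cong; cong₂; module ≡-Reasoning)
open import Function using (_∘_; id)
open import Level using (Level)

private
  variable
    a p : Level
    A : Set a

⌊⌋-true : ∀ {P : Set p} (P? : Dec P) → P → ⌊ P? ⌋ ≡ true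
⌊⌋-true P? x = trans (isYes≗does P?) (dec-true P? x)

⌊⌋-false : ∀ {P : Set p} (P? : Dec P) → ¬ P → ⌊ P? ⌋ ≡ false
⌊⌋-false P? ¬x = trans (isYes≗does P?) (dec-false P? ¬x)

does-≟-true : ∀ b → does (b Bool.≟ true) ≡ b
does-≟-true true  = refl
does-≟-true false = refl

any-∈ : (f : A → Bool) {x : A} {xs : List A} → x ∈ xs → f x ≡ true → any f xs ≡ true
any-∈ f {xs = y ∷ _}  (here refl) fx rewrite fx = refl
any-∈ f {xs = y ∷ ys} (there x∈ys) fx rewrite any-∈ f x∈ys fx = ∨-zeroʳ (f y)

indicator : Bool → ℕ
indicator true  = 1
indicator false = 0

length-filter≡sum : ∀ {P : Pred A p} (P? : Decidable P) xs →
  length (filter P? xs) ≡ sum (map (indicator ∘ does ∘ P?) xs)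
length-filter≡sum P? []       = refl
length-filter≡sum P? (x ∷ xs) with does (P? x)
... | true  = cong suc (length-filter≡sum P? xs)
... | false = length-filter≡sum P? xs

length-concatMap : ∀ {B : Set} (f : A → List B) xs →
  length (concatMap f xs) ≡ sum (map (length ∘ f) xs)
length-concatMap f []       = refl
length-concatMap f (x ∷ xs) = trans (length-++ (f x)) (cong (length (f x) +_) (length-concatMap f xs))

sum-shift : ∀ (f g h : A → ℕ) c {xs} → All (λ x → f x + g x ≡ c + h x) xs →
  sum (map f xs) + sum (map g xs) ≡ length xs * c + sum (map h xs)
sum-shift f g h c []                  = refl
sum-shift f g h c {x ∷ xs} (eq ∷ eqs) = begin
  (f x + sum (map f xs)) + (g x + sum (map g xs))  ≡⟨ interchange (f x) _ (g x) _ ⟩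
  (f x + g x) + (sum (map f xs) + sum (map g xs))  ≡⟨ cong₂ _+_ eq (sum-shift f g h c eqs) ⟩
  (c + h x) + (length xs * c + sum (map h xs))     ≡⟨ interchange c (h x) _ _ ⟩
  (c + length xs * c) + (h x + sum (map h xs))     ∎
  where open ≡-Reasoning

module _ {N : ℕ} (G : Graph N) where

  Near : Fin N → Fin N → Set
  Near u w = u ≡ w ⊎ G u w ≡ true

  reach-refl : ∀ d v → reach G d v v ≡ true
  reach-refl zero    v = ⌊⌋-true (v ≟ v) refl
  reach-refl (suc d) v rewrite reach-refl d v = refl

  reach-near : ∀ d {u w v} → Near u w → reach G d w v ≡ true → reach G (suc d) u v ≡ true
  reach-near d {u} {w} {v} (inj₂ Guw) r
    rewrite any-∈ (λ x → G u x ∧ reach G d x v) (∈-allFin w) (cong₂ _∧_ Guw r) =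
    ∨-zeroʳ (reach G d u v)
  reach-near d (inj₁ refl) r rewrite r = refl

  reach-zero-≢ : ∀ {u v} → u ≢ v → reach G 0 u v ≡ false
  reach-zero-≢ {u} {v} = ⌊⌋-false (u ≟ v)

  reach-one-nonadjacent : ∀ {u v} → u ≢ v → G u v ≡ false → reach G 1 u v ≡ false
  reach-one-nonadjacent {u} {v} u≢v Guv rewrite reach-zero-≢ u≢v = no-witness (allFin N)
    where
    no-witness : ∀ ws → any (λ w → G u w ∧ ⌊ w ≟ v ⌋) ws ≡ false
    no-witness []       = refl
    no-witness (w ∷ ws) with w ≟ v
    ... | yes refl rewrite Guv = no-witness ws
    ... | no _     rewrite ∧-zeroʳ (G u w) = no-witness ws

  least-found : ∀ u v d {f} → reach G d u v ≡ true → least G u v d (suc f) ≡ d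
  least-found u v d r rewrite r = refl

  least-skip : ∀ u v d {f} → reach G d u v ≡ false → least G u v d (suc f) ≡ least G u v (suc d) f
  least-skip u v d r rewrite r = refl

-- At least four vertices are needed because dist only searches distances below N.
module _ {f : ℕ} (G : Graph (4 + f)) {u v : Fin (4 + f)} (u≢v : u ≢ v) where

  dist-adjacent : G u v ≡ true → dist G u v ≡ 1
  dist-adjacent adj = trans (least-skip G u v 0 (reach-zero-≢ G u≢v))
                            (least-found G u v 1 (reach-near G 0 (inj₂ adj) (reach-refl G 0 v)))

  dist-two : G u v ≡ false → reach G 2 u v ≡ true → dist G u v ≡ 2
  dist-two adj r₂ = trans (least-skip G u v 0 (reach-zero-≢ G u≢v))
                  (trans (least-skip G u v 1 (reach-one-nonadjacent G u≢v adj))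
                         (least-found G u v 2 r₂))

  dist-three : G u v ≡ false → reach G 2 u v ≡ false → reach G 3 u v ≡ true → dist G u v ≡ 3
  dist-three adj r₂ r₃ = trans (least-skip G u v 0 (reach-zero-≢ G u≢v))
                       (trans (least-skip G u v 1 (reach-one-nonadjacent G u≢v adj))
                       (trans (least-skip G u v 2 r₂) (least-found G u v 3 r₃)))

dist-+-adjacency : ∀ {N} (G : Graph N) {u v} → 4 ≤ N → u ≢ v → reach G 3 u v ≡ true →
  dist G u v + indicator (G u v) ≡ 2 + indicator (does (dist G u v ℕ.≟ 3))
dist-+-adjacency G {u} {v} (s≤s (s≤s (s≤s (s≤s _)))) u≢v r₃ with G u v in adj
... | true  rewrite dist-adjacent G u≢v adj = refl
... | false = by-reach₂ (reach G 2 u v) refl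
  where
  by-reach₂ : ∀ b → reach G 2 u v ≡ b →
    dist G u v + 0 ≡ 2 + indicator (does (dist G u v ℕ.≟ 3))
  by-reach₂ true  r₂ rewrite dist-two G u≢v adj r₂ = refl
  by-reach₂ false r₂ rewrite dist-three G u≢v adj r₂ r₃ = refl

tabulate-toℕ≡applyUpTo : ∀ {B : Set} n (f : ℕ → B) → tabulate {n = n} (f ∘ toℕ) ≡ applyUpTo f n
tabulate-toℕ≡applyUpTo zero    f = refl
tabulate-toℕ≡applyUpTo (suc n) f = cong (f 0 ∷_) (tabulate-toℕ≡applyUpTo n (f ∘ suc))

map-toℕ-allFin : ∀ n → map toℕ (allFin n) ≡ upTo n
map-toℕ-allFin n = trans (map-tabulate id toℕ) (tabulate-toℕ≡applyUpTo n id)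

count-above : ∀ n a → sum (map (indicator ∘ does ∘ (a <?_)) (upTo n)) ≡ n ∸ suc a
count-above zero    a = refl
count-above (suc n) a = begin
  sum (map g (applyUpTo suc n))          ≡⟨ cong (sum ∘ map g) (sym (map-upTo suc n)) ⟩
  sum (map g (map suc (upTo n)))         ≡⟨ cong sum (sym (map-∘ (upTo n))) ⟩
  sum (map (g ∘ suc) (upTo n))           ≡⟨ shifted a ⟩
  suc n ∸ suc a                          ∎
  where
  open ≡-Reasoning
  g = indicator ∘ does ∘ (a <?_)
  shifted : ∀ a → sum (map (indicator ∘ does ∘ (a <?_) ∘ suc) (upTo n)) ≡ n ∸ a
  shifted zero    = trans (sum-ones (upTo n)) (length-upTo n)
    where
    sum-ones : ∀ (xs : List ℕ) → sum (map (λ _ → 1) xs) ≡ length xs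
    sum-ones []       = refl
    sum-ones (_ ∷ xs) = cong suc (sum-ones xs)
  shifted (suc a) = count-above n a

pairs-distinct : ∀ N → All (λ uv → proj₁ uv ≢ proj₂ uv) (pairs N)
pairs-distinct N = concat⁺ (map⁺ (All.universal (λ u → map⁺ (All.map
  (λ u<v u≡v → <-irrefl (cong toℕ u≡v) u<v) (all-filter (λ v → toℕ u <? toℕ v) (allFin N)))) (allFin N)))

length-pairs : ∀ N → length (pairs N) ≡ sum (map (λ a → N ∸ suc a) (upTo N))
length-pairs N = begin
  length (pairs N)                                   ≡⟨ length-concatMap row (allFin N) ⟩
  sum (map (length ∘ row) (allFin N))                ≡⟨ cong sum (map-cong length-row (allFin N)) ⟩
  sum (map ((λ a → N ∸ suc a) ∘ toℕ) (allFin N))     ≡⟨ cong sum (map-∘ (allFin N)) ⟩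
  sum (map (λ a → N ∸ suc a) (map toℕ (allFin N)))   ≡⟨ cong (sum ∘ map (λ a → N ∸ suc a)) (map-toℕ-allFin N) ⟩
  sum (map (λ a → N ∸ suc a) (upTo N))               ∎
  where
  open ≡-Reasoning
  row : Fin N → List (Fin N × Fin N)
  row u = map (u ,_) (filter (λ v → toℕ u <? toℕ v) (allFin N))
  length-row : ∀ u → length (row u) ≡ N ∸ suc (toℕ u)
  length-row u = begin
    length (row u)                                         ≡⟨ length-map (u ,_) (filter (λ v → toℕ u <? toℕ v) (allFin N)) ⟩
    length (filter (λ v → toℕ u <? toℕ v) (allFin N))      ≡⟨ length-filter≡sum (λ v → toℕ u <? toℕ v) (allFin N) ⟩
    sum (map (g ∘ toℕ) (allFin N))                         ≡⟨ cong sum (map-∘ (allFin N)) ⟩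
    sum (map g (map toℕ (allFin N)))                       ≡⟨ cong (sum ∘ map g) (map-toℕ-allFin N) ⟩
    sum (map g (upTo N))                                   ≡⟨ count-above N (toℕ u) ⟩
    N ∸ suc (toℕ u)                                        ∎
    where g = indicator ∘ does ∘ (toℕ u <?_)

sum-downFrom-suc : ∀ n → sum (map (λ a → suc n ∸ suc a) (upTo (suc n))) ≡ n + sum (map (λ a → n ∸ suc a) (upTo n))
sum-downFrom-suc n = cong (λ xs → n + sum xs) (begin
  map (λ a → suc n ∸ suc a) (applyUpTo suc n)        ≡⟨ cong (map _) (sym (map-upTo suc n)) ⟩
  map (λ a → suc n ∸ suc a) (map suc (upTo n))       ≡⟨ sym (map-∘ (upTo n)) ⟩
  map (λ a → n ∸ suc a) (upTo n)                     ∎)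
  where open ≡-Reasoning

sum-downFrom*2 : ∀ n → sum (map (λ a → n ∸ suc a) (upTo n)) * 2 ≡ n * (n ∸ 1)
sum-downFrom*2 zero          = refl
sum-downFrom*2 (suc zero)    = refl
sum-downFrom*2 (suc (suc m)) = begin
  sum (map (λ a → suc (suc m) ∸ suc a) (upTo (suc (suc m)))) * 2
                          ≡⟨ cong (_* 2) (sum-downFrom-suc (suc m)) ⟩
  (suc m + S) * 2         ≡⟨ solve 2 (λ m S → (con 1 :+ m :+ S) :* con 2 := con 2 :* (con 1 :+ m) :+ S :* con 2) refl m S ⟩
  2 * suc m + S * 2       ≡⟨ cong (2 * suc m +_) (sum-downFrom*2 (suc m)) ⟩
  2 * suc m + suc m * m   ≡⟨ solve 1 (λ m → con 2 :* (con 1 :+ m) :+ (con 1 :+ m) :* m := (con 2 :+ m) :* (con 1 :+ m)) refl m ⟩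
  suc (suc m) * suc m     ∎
  where
  open ≡-Reasoning
  open +-*-Solver
  S = sum (map (λ a → suc m ∸ suc a) (upTo (suc m)))

wiener-+-edgeCount : ∀ {N} (G : Graph N) → 4 ≤ N → (∀ u v → reach G 3 u v ≡ true) →
  wiener G + edgeCount G ≡ N * (N ∸ 1) + wienerPolarity G
wiener-+-edgeCount {N} G 4≤N diameter≤3 = begin
  wiener G + edgeCount G                   ≡⟨ cong (wiener G +_) edgeCount≡ ⟩
  sum (map d P) + sum (map adj P)          ≡⟨ sum-shift d adj d≡3 2 (All.map pointwise (pairs-distinct N)) ⟩
  length P * 2 + sum (map d≡3 P)           ≡⟨ cong₂ _+_ (trans (cong (_* 2) (length-pairs N)) (sum-downFrom*2 N))
                                                        (sym (length-filter≡sum (λ uv → d uv ℕ.≟ 3) P)) ⟩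
  N * (N ∸ 1) + wienerPolarity G           ∎
  where
  open ≡-Reasoning
  P = pairs N
  d adj d≡3 : Fin N × Fin N → ℕ
  d   (u , v) = dist G u v
  adj (u , v) = indicator (G u v)
  d≡3 uv      = indicator (does (d uv ℕ.≟ 3))
  edgeCount≡ : edgeCount G ≡ sum (map adj P)
  edgeCount≡ = trans (length-filter≡sum (λ (u , v) → G u v Bool.≟ true) P)
                     (cong sum (map-cong (λ (u , v) → cong indicator (does-≟-true (G u v))) P))
  pointwise : ∀ {uv} → proj₁ uv ≢ proj₂ uv → d uv + adj uv ≡ 2 + d≡3 uv
  pointwise {u , v} u≢v = dist-+-adjacency G 4≤N u≢v (diameter≤3 u v)

module _ (k : ℕ) where

  hubIndex : Fin (k + k) → Fin k
  hubIndex u = [ id , id ]′ (splitAt k u)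

  hub : Fin (k + k) → Fin (k + k)
  hub u = hubIndex u ↑ˡ k

  sun-clique : ∀ {u v i j} → splitAt k u ≡ inj₁ i → splitAt k v ≡ inj₁ j → sun k u v ≡ not ⌊ i ≟ j ⌋
  sun-clique {u} {v} eu ev rewrite eu | ev = refl

  sunSC-diag : ∀ i → sunSC k i i ≡ true
  sunSC-diag i rewrite ⌊⌋-true (toℕ i ℕ.≟ toℕ i) refl = refl

  clique-near : ∀ i j → Near (sun k) (i ↑ˡ k) (j ↑ˡ k)
  clique-near i j with i ≟ j
  ... | yes refl = inj₁ refl
  ... | no i≢j   = inj₂ (trans (sun-clique (splitAt-↑ˡ k i k) (splitAt-↑ˡ k j k))
                               (cong not (⌊⌋-false (i ≟ j) i≢j)))

  near-hub : ∀ u → Near (sun k) u (hub u)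
  near-hub u with splitAt k u in eq
  ... | inj₁ i = inj₁ (sym (splitAt⁻¹-↑ˡ eq))
  ... | inj₂ i rewrite splitAt-↑ˡ k i k = inj₂ (sunSC-diag i)

  hub-near : ∀ v → Near (sun k) (hub v) v
  hub-near v with splitAt k v in eq
  ... | inj₁ i = inj₁ (splitAt⁻¹-↑ˡ eq)
  ... | inj₂ i rewrite splitAt-↑ˡ k i k = inj₂ (sunSC-diag i)

  sun-diameter≤3 : ∀ u v → reach (sun k) 3 u v ≡ true
  sun-diameter≤3 u v =
    reach-near (sun k) 2 (near-hub u)
      (reach-near (sun k) 1 (clique-near (hubIndex u) (hubIndex v))
        (reach-near (sun k) 0 (hub-near v) (reach-refl (sun k) 0 v)))

proposition1 : (k : ℕ) → 3 ≤ k →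
    let n = k + k
        m = edgeCount (sun k)
    in wiener (sun k) ≡ n * (n ∸ 1) + wienerPolarity (sun k) ∸ m
proposition1 k 3≤k = begin
  W                                        ≡⟨ sym (m+n∸n≡m W M) ⟩
  W + M ∸ M                                ≡⟨ cong (_∸ M) (wiener-+-edgeCount (sun k) 4≤n (sun-diameter≤3 k)) ⟩
  n * (n ∸ 1) + wienerPolarity (sun k) ∸ M ∎
  where
  open ≡-Reasoning
  n = k + k
  W = wiener (sun k)
  M = edgeCount (sun k)
  4≤n : 4 ≤ n
  4≤n = +-mono-≤ 3≤k (≤-trans (s≤s z≤n) 3≤k)
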